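{- Let $G$ be a uniquely $C_4^{+}$-saturated graph with $k\geq 1$ triangles, and let $A$ be the set of all vertices of $G$ that lie in some triangle of $G$. If $N^{2}(A)\neq\emptyset$, then all vertices of $V(G)\setminus A$ have the same degree in $G$.
   Context: All graphs are finite, simple and undirected. $C_4^{+}$ (the diamond) is the graph obtained from a $4$-cycle by adding one chord, i.e. $K_4$ minus an edge. For a graph $H$, a graph $G$ is uniquely $H$-saturated if $G$ contains no subgraph isomorphic to $H$, but for every pair of non-adjacent vertices $u,v$ of $G$, the graph $G+uv$ contains exactly one subgraph isomorphic to $H$. A triangle is a subgraph isomorphic to $K_3$. For $U\subseteq V(G)$, $d(v,U)=\min\{d(v,u):u\in U\}$ and $N^{2}(U)=\{v\in V(G): d(v,U)=2\}$. -}

module Defs where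

open import Data.Nat using (ℕ)
open import Data.Fin using (Fin; _<_; _≟_)
open import Data.Bool using (Bool; true; false; _∨_; _∧_)
open import Data.List using (List; length; filterᵇ; allFin)
open import Data.Product using (Σ; ∃; ∃-syntax; _×_; _,_)
open import Relation.Binary.PropositionalEquality using (_≡_; _≢_)
open import Relation.Nullary using (¬_)
open import Relation.Nullary.Decidable using (⌊_⌋)

record Graph (n : ℕ) : Set where
  field
    adj   : Fin n → Fin n → Bool
    sym   : ∀ u v → adj u v ≡ adj v u
    irrefl : ∀ v → adj v v ≡ false
open Graph public

Rel : ℕ → Set
Rel n = Fin n → Fin n → Bool

addEdge : ∀ {n} → Rel n → Fin n → Fin n → Rel n
addEdge E u v x y =
  E x y ∨ ((⌊ x ≟ u ⌋ ∧ ⌊ y ≟ v ⌋) ∨ (⌊ x ≟ v ⌋ ∧ ⌊ y ≟ u ⌋))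

-- A subgraph isomorphic to the diamond C4⁺ = K4 - e is determined by its
-- chord {a,b} (the two degree-3 vertices) and its tips {c,d} (the two
-- degree-2 vertices), where a,b,c,d are distinct and ab,ac,bc,ad,bd are edges.
-- We record each such subgraph exactly once by requiring a < b and c < d.
record DiamondCopy {n : ℕ} (E : Rel n) : Set where
  constructor diamond
  field
    a b c d : Fin n
    a<b : a < b
    c<d : c < d
    a≢c : a ≢ c
    a≢d : a ≢ d
    b≢c : b ≢ c
    b≢d : b ≢ d
    ab : E a b ≡ true
    ac : E a c ≡ true
    bc : E b c ≡ true
    ad : E a d ≡ true
    bd : E b d ≡ true

SameCopy : ∀ {n} {E : Rel n} → DiamondCopy E → DiamondCopy E → Set
SameCopy D₁ D₂ =
  (DiamondCopy.a D₁ ≡ DiamondCopy.a D₂) × (DiamondCopy.b D₁ ≡ DiamondCopy.b D₂) ×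
  (DiamondCopy.c D₁ ≡ DiamondCopy.c D₂) × (DiamondCopy.d D₁ ≡ DiamondCopy.d D₂)

ExactlyOneDiamond : ∀ {n} → Rel n → Set
ExactlyOneDiamond E = DiamondCopy E × (∀ (D₁ D₂ : DiamondCopy E) → SameCopy D₁ D₂)

UniquelyDiamondSaturated : ∀ {n} → Graph n → Set
UniquelyDiamondSaturated G =
  ¬ DiamondCopy (adj G) ×
  (∀ u v → u ≢ v → adj G u v ≡ false → ExactlyOneDiamond (addEdge (adj G) u v))

IsTriangle : ∀ {n} → Graph n → Fin n → Fin n → Fin n → Set
IsTriangle G x y z = (adj G x y ≡ true) × (adj G y z ≡ true) × (adj G x z ≡ true)

HasTriangle : ∀ {n} → Graph n → Set
HasTriangle G = ∃[ x ] ∃[ y ] ∃[ z ] IsTriangle G x y z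

InA : ∀ {n} → Graph n → Fin n → Set
InA G v = ∃[ y ] ∃[ z ] IsTriangle G v y z

-- v ∈ N²(A), i.e. d(v, A) = 2: v ∉ A (distance ≠ 0), no neighbour of v is in A
-- (distance ≠ 1), and some neighbour of v has a neighbour in A (distance ≤ 2).
InN2A : ∀ {n} → Graph n → Fin n → Set
InN2A G v =
  ¬ InA G v ×
  (∀ w → adj G v w ≡ true → ¬ InA G w) ×
  (∃[ w ] ∃[ a ] (adj G v w ≡ true) × (adj G w a ≡ true) × InA G a)

degree : ∀ {n} → Graph n → Fin n → ℕ
degree {n} G v = length (filterᵇ (adj G v) (allFin n))

{-# OPTIONS --safe #-}
-- Since G has no diamond, the unique diamond of G + pq (for non-adjacent p, q) uses pq
-- either as its chord, so that p and q have two common neighbours, or as a side, so that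
-- they have a common neighbour lying in a triangle; either way p and q have a common
-- neighbour avoiding any prescribed vertex outside A. For an edge xy with x ∉ A, send y to
-- x and each other neighbour z of x (not adjacent to y, as x ∉ A) to a common neighbour
-- w ≠ x of y and z. This is injective: two such z would give x and w, which are
-- non-adjacent as x ∉ A, the three common neighbours y, z, z′, hence two diamonds in
-- G + xw. So degrees are constant along edges between vertices outside A, and a vertex v
-- with d(v, A) ≥ 2 is joined to every vertex outside A by such a path of length ≤ 2.
module Submission where

open import Defs hiding (sym)
open import Data.Nat using (ℕ; _≤_)
open import Data.Nat.Properties using (≤-antisym)
open import Data.Fin using (Fin; zero; suc; _<_; _≟_)
open import Data.Fin.Properties using (<-cmp; <⇒≢; injective⇒≤)
open import Data.Bool using (true; false; _∨_; _∧_; T?)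
open import Data.Bool.Properties using (T-≡; ∨-comm; ∧-comm; ∨-zeroʳ; ∨-identityʳ; ∧-zeroʳ; ¬-not)
open import Data.List using (List; _∷_; length; lookup; filterᵇ; allFin)
import Data.List.Relation.Unary.All as All
open import Data.List.Relation.Unary.AllPairs using (_∷_)
open import Data.List.Relation.Unary.Any using (index)
open import Data.List.Relation.Unary.Unique.Propositional using (Unique)
import Data.List.Relation.Unary.Unique.Propositional.Properties as Unique
open import Data.List.Membership.Propositional using (_∈_)
open import Data.List.Membership.Propositional.Properties using (∈-lookup; ∈-filter⁺; ∈-filter⁻; ∈-allFin)
open import Data.List.Membership.Setoid.Properties using (index-injective)
open import Data.Empty using (⊥; ⊥-elim)
open import Data.Product using (Σ; ∃-syntax; _×_; _,_; proj₁; proj₂)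
open import Data.Sum using (_⊎_; inj₁; inj₂)
open import Function using (_∘_)
open import Function.Bundles using (Equivalence)
open import Function.Definitions using (Injective)
open import Relation.Binary.Definitions using (tri<; tri≈; tri>)
open import Relation.Binary.PropositionalEquality
  using (_≡_; _≢_; refl; sym; trans; cong; cong₂; subst; subst₂; ≢-sym; setoid)
open import Relation.Nullary using (¬_; yes; no; contradiction)
open import Relation.Nullary.Decidable using (⌊_⌋)

private
  variable
    n : ℕ
    A B : Set
    p q r s t u v w x y z z′ : Fin n

lookup-injective : {xs : List A} → Unique xs → ∀ {i j} → lookup xs i ≡ lookup xs j → i ≡ j
lookup-injective {xs = _ ∷ _} _          {zero}  {zero}  _  = refl
lookup-injective              (x∉xs ∷ _) {zero}  {suc j} eq = contradiction eq (All.lookup x∉xs (∈-lookup j))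
lookup-injective              (x∉xs ∷ _) {suc i} {zero}  eq = contradiction (sym eq) (All.lookup x∉xs (∈-lookup i))
lookup-injective              (_ ∷ uniq) {suc i} {suc j} eq = cong suc (lookup-injective uniq eq)

length-≤-of-injective-relation :
  {R : A → B → Set} {xs : List A} {ys : List B} → Unique xs →
  (∀ {a} → a ∈ xs → ∃[ b ] b ∈ ys × R a b) →
  (∀ {a a′} → a ∈ xs → a′ ∈ xs → ∀ {b} → R a b → R a′ b → a ≡ a′) →
  length xs ≤ length ys
length-≤-of-injective-relation {R = R} {xs} uniq image injective = injective⇒≤ image-index-injective
  where
  image-index : Fin (length xs) → Fin _
  image-index i = index (proj₁ (proj₂ (image (∈-lookup i))))

  image-index-injective : Injective _≡_ _≡_ image-index
  image-index-injective {i} {j} eq with image (∈-lookup {xs = xs} i) | image (∈-lookup {xs = xs} j)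
  ... | b , b∈ys , Rib | b′ , b′∈ys , Rjb′ =
    lookup-injective uniq
      (injective (∈-lookup i) (∈-lookup j) Rib (subst (R _) (sym (index-injective (setoid _) b∈ys b′∈ys eq)) Rjb′))

SamePair : A → A → A → A → Set
SamePair s t p q = (s ≡ p × t ≡ q) ⊎ (s ≡ q × t ≡ p)

SamePair-cancelˡ : SamePair s t p q → SamePair s t p r → p ≢ r → q ≡ r
SamePair-cancelˡ (inj₁ (refl , refl)) (inj₁ (_ , refl))    _   = refl
SamePair-cancelˡ (inj₁ (refl , refl)) (inj₂ (p≡r , _))     p≢r = contradiction p≡r p≢r
SamePair-cancelˡ (inj₂ (refl , refl)) (inj₁ (q≡p , p≡r))   p≢r = contradiction p≡r p≢r
SamePair-cancelˡ (inj₂ (refl , refl)) (inj₂ (q≡r , _))     _   = q≡r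

module _ (E : Rel n) where

  addEdge-old : E s t ≡ true → addEdge E p q s t ≡ true
  addEdge-old st rewrite st = refl

  addEdge-new : addEdge E p q p q ≡ true
  addEdge-new {p} {q} with p ≟ p | q ≟ q
  ... | yes _   | yes _   = ∨-zeroʳ (E p q)
  ... | no p≢p  | _       = contradiction refl p≢p
  ... | yes _   | no q≢q  = contradiction refl q≢q

  addEdge-away : p ≢ t → q ≢ t → addEdge E p q s t ≡ E s t
  addEdge-away {p} {t} {q} {s} p≢t q≢t with t ≟ q | t ≟ p
  ... | yes refl | _        = contradiction refl q≢t
  ... | no _     | yes refl = contradiction refl p≢t
  ... | no _     | no _
    rewrite ∧-zeroʳ ⌊ s ≟ p ⌋ | ∧-zeroʳ ⌊ s ≟ q ⌋ = ∨-identityʳ (E s t)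

  addEdge-edge⁻ : addEdge E p q s t ≡ true → E s t ≡ true ⊎ SamePair s t p q
  addEdge-edge⁻ {p} {q} {s} {t} st with E s t | s ≟ p | t ≟ q | s ≟ q | t ≟ p
  ... | true  | _        | _        | _        | _        = inj₁ refl
  ... | false | yes s≡p  | yes t≡q  | _        | _        = inj₂ (inj₁ (s≡p , t≡q))
  ... | false | _        | _        | yes s≡q  | yes t≡p  = inj₂ (inj₂ (s≡q , t≡p))
  ... | false | no _     | _        | no _     | _        = contradiction st λ ()
  ... | false | no _     | _        | yes _    | no _     = contradiction st λ ()
  ... | false | yes _    | no _     | no _     | _        = contradiction st λ ()
  ... | false | yes _    | no _     | yes _    | no _     = contradiction st λ ()

  addEdge-sym : (∀ s t → E s t ≡ E t s) → ∀ s t → addEdge E p q s t ≡ addEdge E p q t s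
  addEdge-sym {p} {q} E-sym s t = cong₂ _∨_ (E-sym s t)
    (trans (∨-comm (⌊ s ≟ p ⌋ ∧ ⌊ t ≟ q ⌋) _)
           (cong₂ _∨_ (∧-comm ⌊ s ≟ q ⌋ ⌊ t ≟ p ⌋) (∧-comm ⌊ s ≟ p ⌋ ⌊ t ≟ q ⌋)))

  addEdge-old⁻ : SamePair u v p q → u ≢ t → v ≢ t → addEdge E p q s t ≡ true → E s t ≡ true
  addEdge-old⁻ (inj₁ (refl , refl)) u≢t v≢t st = trans (sym (addEdge-away u≢t v≢t)) st
  addEdge-old⁻ (inj₂ (refl , refl)) u≢t v≢t st = trans (sym (addEdge-away v≢t u≢t)) st

_+edge_ : (G : Graph n) {u v : Fin n} → u ≢ v → Graph n
_+edge_ G {u} {v} u≢v = record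
  { adj    = addEdge (adj G) u v
  ; sym    = addEdge-sym (adj G) (Graph.sym G)
  ; irrefl = irrefl′
  }
  where
  irrefl′ : ∀ s → addEdge (adj G) u v s s ≡ false
  irrefl′ s rewrite irrefl G s with s ≟ u | s ≟ v
  ... | yes refl | yes refl = contradiction refl u≢v
  ... | yes _    | no _     = refl
  ... | no _     | yes _    = refl
  ... | no _     | no _     = refl

module _ (H : Graph n) where

  edge⇒≢ : adj H u v ≡ true → u ≢ v
  edge⇒≢ {u} uu refl = contradiction (trans (sym (irrefl H u)) uu) λ ()

  edge-sym : adj H u v ≡ true → adj H v u ≡ true
  edge-sym {u} {v} uv = trans (Graph.sym H v u) uv

  private
    ordered : ∀ {a b c d} → a < b → c < d → adj H a b ≡ true →
              adj H a c ≡ true → adj H b c ≡ true → adj H a d ≡ true → adj H b d ≡ true →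
              DiamondCopy (adj H)
    ordered a<b c<d ab ac bc ad bd =
      diamond _ _ _ _ a<b c<d (edge⇒≢ ac) (edge⇒≢ ad) (edge⇒≢ bc) (edge⇒≢ bd) ab ac bc ad bd

  diamond-with-tips :
    r ≢ s → adj H p q ≡ true →
    adj H p r ≡ true → adj H q r ≡ true → adj H p s ≡ true → adj H q s ≡ true →
    Σ (DiamondCopy (adj H)) λ D → SamePair (DiamondCopy.c D) (DiamondCopy.d D) r s
  diamond-with-tips {r} {s} {p} {q} r≢s pq pr qr ps qs with <-cmp p q | <-cmp r s
  ... | tri≈ _ p≡q _ | _              = contradiction p≡q (edge⇒≢ pq)
  ... | _            | tri≈ _ r≡s _   = contradiction r≡s r≢s
  ... | tri< p<q _ _ | tri< r<s _ _   = ordered p<q r<s pq pr qr ps qs , inj₁ (refl , refl)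
  ... | tri< p<q _ _ | tri> _ _ s<r   = ordered p<q s<r pq ps qs pr qr , inj₂ (refl , refl)
  ... | tri> _ _ q<p | tri< r<s _ _   = ordered q<p r<s (edge-sym pq) qr pr qs ps , inj₁ (refl , refl)
  ... | tri> _ _ q<p | tri> _ _ s<r   = ordered q<p s<r (edge-sym pq) qs ps qr pr , inj₂ (refl , refl)

  degree-≤-of-injective-relation :
    {R : Fin n → Fin n → Set} →
    (∀ {z} → adj H x z ≡ true → ∃[ w ] adj H y w ≡ true × R z w) →
    (∀ {z z′} → adj H x z ≡ true → adj H x z′ ≡ true → ∀ {w} → R z w → R z′ w → z ≡ z′) →
    degree H x ≤ degree H y
  degree-≤-of-injective-relation {x} {y} image injective =
    length-≤-of-injective-relation (Unique.filter⁺ (T? ∘ adj H x) (Unique.allFin⁺ _))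
      (λ z∈ → let w , yw , Rzw = image (neighbour z∈)
              in w , ∈-filter⁺ (T? ∘ adj H y) (∈-allFin w) (Equivalence.from T-≡ yw) , Rzw)
      (λ z∈ z′∈ {w} → injective (neighbour z∈) (neighbour z′∈) {w})
    where
    neighbour : ∀ {v z} → z ∈ filterᵇ (adj H v) (allFin _) → adj H v z ≡ true
    neighbour {v} z∈ = Equivalence.to T-≡ (proj₂ (∈-filter⁻ (T? ∘ adj H v) {xs = allFin _} z∈))

CommonNeighbour : Graph n → Fin n → Fin n → Fin n → Set
CommonNeighbour G p q w = adj G p w ≡ true × adj G q w ≡ true

data NewDiamond (G : Graph n) (p q : Fin n) : Set where
  as-chord : ∀ {c d} → c ≢ d → CommonNeighbour G p q c → CommonNeighbour G p q d → NewDiamond G p q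
  as-side  : ∀ {b} → CommonNeighbour G p q b → InA G b → NewDiamond G p q

module _ (G : Graph n) where
  private
    E = adj G

    flip : addEdge E p q s t ≡ true → addEdge E p q t s ≡ true
    flip {s = s} {t} st = trans (addEdge-sym E (Graph.sym G) t s) st

  CommonNeighbour-resp : SamePair u v p q → CommonNeighbour G u v w → CommonNeighbour G p q w
  CommonNeighbour-resp (inj₁ (refl , refl)) (uw , vw) = uw , vw
  CommonNeighbour-resp (inj₂ (refl , refl)) (uw , vw) = vw , uw

  chord-new : SamePair u v p q → s ≢ t → u ≢ s → v ≢ s → u ≢ t → v ≢ t →
              addEdge E p q u s ≡ true → addEdge E p q v s ≡ true →
              addEdge E p q u t ≡ true → addEdge E p q v t ≡ true → NewDiamond G p q
  chord-new {u} {v} {p} {q} uv≐pq s≢t u≢s v≢s u≢t v≢t us vs ut vt = as-chord s≢t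
    (CommonNeighbour-resp uv≐pq (old u≢s v≢s us , old u≢s v≢s vs))
    (CommonNeighbour-resp uv≐pq (old u≢t v≢t ut , old u≢t v≢t vt))
    where
    old : ∀ {s t} → u ≢ t → v ≢ t → addEdge E p q s t ≡ true → E s t ≡ true
    old = addEdge-old⁻ E uv≐pq

  side-new : SamePair u v p q → u ≢ w → v ≢ w → u ≢ t → v ≢ t →
             addEdge E p q u w ≡ true → addEdge E p q v w ≡ true →
             addEdge E p q u t ≡ true → addEdge E p q w t ≡ true → NewDiamond G p q
  side-new {u} {v} {p} {q} {t = t} uv≐pq u≢w v≢w u≢t v≢t uw vw ut wt =
    as-side (CommonNeighbour-resp uv≐pq (uw′ , old u≢w v≢w vw))
            (u , t , edge-sym G uw′ , old u≢t v≢t ut , old u≢t v≢t wt)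
    where
    old : ∀ {s t} → u ≢ t → v ≢ t → addEdge E p q s t ≡ true → E s t ≡ true
    old = addEdge-old⁻ E uv≐pq
    uw′ = old u≢w v≢w uw

  new-diamond-shape : ¬ DiamondCopy E → DiamondCopy (addEdge E p q) → NewDiamond G p q
  new-diamond-shape {p} {q} no-diamond (diamond a b c d a<b c<d a≢c a≢d b≢c b≢d ab ac bc ad bd)
    with addEdge-edge⁻ E ab
  ... | inj₂ ab≐pq = chord-new ab≐pq (<⇒≢ c<d) a≢c b≢c a≢d b≢d ac bc ad bd
  ... | inj₁ ab′ with addEdge-edge⁻ E ac
  ...   | inj₂ ac≐pq =
    side-new ac≐pq (<⇒≢ a<b) (≢-sym b≢c) a≢d (<⇒≢ c<d) ab (flip bc) ad bd
  ...   | inj₁ ac′ with addEdge-edge⁻ E bc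
  ...     | inj₂ bc≐pq =
    side-new bc≐pq (≢-sym (<⇒≢ a<b)) (≢-sym a≢c) b≢d (<⇒≢ c<d) (flip ab) (flip ac) bd ad
  ...     | inj₁ bc′ with addEdge-edge⁻ E ad
  ...       | inj₂ ad≐pq =
    side-new ad≐pq (<⇒≢ a<b) (≢-sym b≢d) a≢c (≢-sym (<⇒≢ c<d)) ab (flip bd) ac bc
  ...       | inj₁ ad′ with addEdge-edge⁻ E bd
  ...         | inj₂ bd≐pq =
    side-new bd≐pq (≢-sym (<⇒≢ a<b)) (≢-sym a≢d) b≢c (≢-sym (<⇒≢ c<d)) (flip ab) (flip ad) bc ac
  ...         | inj₁ bd′ =
    contradiction (diamond a b c d a<b c<d a≢c a≢d b≢c b≢d ab′ ac′ bc′ ad′ bd′) no-diamond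

module _ {G : Graph n} (saturated : UniquelyDiamondSaturated G) where
  private
    E = adj G

  ¬three-common-neighbours :
    x ≢ w → E x w ≡ false → p ≢ q → p ≢ r → q ≢ r →
    CommonNeighbour G x w p → CommonNeighbour G x w q → CommonNeighbour G x w r → ⊥
  ¬three-common-neighbours {x} {w} {p} {q} {r} x≢w xw p≢q p≢r q≢r (xp , wp) (xq , wq) (xr , wr) =
    let D₁ , tips₁ = diamond-with-tips G+xw p≢q (addEdge-new E) (old xp) (old wp) (old xq) (old wq)
        D₂ , tips₂ = diamond-with-tips G+xw p≢r (addEdge-new E) (old xp) (old wp) (old xr) (old wr)
        _ , _ , c₁≡c₂ , d₁≡d₂ = proj₂ (proj₂ saturated x w x≢w xw) D₁ D₂
    in q≢r (SamePair-cancelˡ tips₁ (subst₂ (λ s t → SamePair s t p r) (sym c₁≡c₂) (sym d₁≡d₂) tips₂) p≢r)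
    where
    G+xw = G +edge x≢w
    old : E s t ≡ true → adj G+xw s t ≡ true
    old = addEdge-old E

  common-neighbour-avoiding :
    ¬ InA G x → p ≢ q → E p q ≡ false → ∃[ w ] CommonNeighbour G p q w × w ≢ x
  common-neighbour-avoiding {x} x∉A p≢q pq
    with new-diamond-shape G (proj₁ saturated) (proj₁ (proj₂ saturated _ _ p≢q pq))
  ... | as-side pqb b∈A = _ , pqb , λ { refl → x∉A b∈A }
  ... | as-chord {c} {d} c≢d pqc pqd with c ≟ x
  ...   | no c≢x   = c , pqc , c≢x
  ...   | yes refl = d , pqd , ≢-sym c≢d

  private module _ (x∉A : ¬ InA G x) (xy : E x y ≡ true) where

    Partner : Fin n → Fin n → Set
    Partner z w = (z ≡ y × w ≡ x) ⊎ (z ≢ y × CommonNeighbour G y z w × w ≢ x)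

    partner : E x z ≡ true → ∃[ w ] E y w ≡ true × Partner z w
    partner {z} xz with z ≟ y
    ... | yes refl = x , edge-sym G xy , inj₁ (refl , refl)
    ... | no z≢y =
      let w , (yw , zw) , w≢x = common-neighbour-avoiding x∉A (≢-sym z≢y) (¬-not λ yz → x∉A (y , z , xy , yz , xz))
      in w , yw , inj₂ (z≢y , (yw , zw) , w≢x)

    partner-injective : E x z ≡ true → E x z′ ≡ true → ∀ {w} → Partner z w → Partner z′ w → z ≡ z′
    partner-injective _ _ (inj₁ (refl , _))     (inj₁ (refl , _))          = refl
    partner-injective _ _ (inj₁ (_ , refl))     (inj₂ (_ , _ , w≢x))       = contradiction refl w≢x
    partner-injective _ _ (inj₂ (_ , _ , w≢x))  (inj₁ (_ , refl))          = contradiction refl w≢x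
    partner-injective {z} {z′} xz xz′ {w} (inj₂ (z≢y , (yw , zw) , w≢x)) (inj₂ (z′≢y , (_ , z′w) , _))
      with z ≟ z′
    ... | yes z≡z′ = z≡z′
    ... | no z≢z′  = ⊥-elim (¬three-common-neighbours
          (≢-sym w≢x) (¬-not λ xw → x∉A (y , w , xy , yw , xw)) (≢-sym z≢y) (≢-sym z′≢y) z≢z′
          (xy , edge-sym G yw) (xz , edge-sym G zw) (xz′ , edge-sym G z′w))

  degree-≤-of-adjacent : ¬ InA G x → E x y ≡ true → degree G x ≤ degree G y
  degree-≤-of-adjacent x∉A xy = degree-≤-of-injective-relation G (partner x∉A xy) (partner-injective x∉A xy)

  degree-≡-of-adjacent : ¬ InA G x → ¬ InA G y → E x y ≡ true → degree G x ≡ degree G y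
  degree-≡-of-adjacent x∉A y∉A xy =
    ≤-antisym (degree-≤-of-adjacent x∉A xy) (degree-≤-of-adjacent y∉A (edge-sym G xy))

  degree-≡-of-far-from-A :
    ¬ InA G v → (∀ w → E v w ≡ true → ¬ InA G w) → ¬ InA G x → degree G x ≡ degree G v
  degree-≡-of-far-from-A {v} {x} v∉A N[v]∩A≡∅ x∉A with x ≟ v
  ... | yes refl = refl
  ... | no x≢v with E x v in xv
  ...   | true  = degree-≡-of-adjacent x∉A v∉A xv
  ...   | false =
    let c , (xc , vc) , _ = common-neighbour-avoiding v∉A x≢v xv
        c∉A = N[v]∩A≡∅ c vc
    in trans (degree-≡-of-adjacent x∉A c∉A xc) (degree-≡-of-adjacent c∉A v∉A (edge-sym G vc))

lemma3p2 : ∀ {n} (G : Graph n) → UniquelyDiamondSaturated G → HasTriangle G →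
    (∃[ v ] InN2A G v) →
    ∀ u w → ¬ InA G u → ¬ InA G w → degree G u ≡ degree G w
lemma3p2 G saturated _ (v , v∉A , N[v]∩A≡∅ , _) u w u∉A w∉A =
  trans (far u∉A) (sym (far w∉A))
  where
  far : ∀ {x} → ¬ InA G x → degree G x ≡ degree G v
  far x∉A = degree-≡-of-far-from-A {G = G} saturated v∉A N[v]∩A≡∅ x∉A
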